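{- Let $k\ge 2$ and let $A=\{a_1,\dots,a_k\}$ be positive integers with $\gcd(a_1,\dots,a_k)=1$ and $a_1$ odd. For $1\le i\le a_1-1$ let $m_i$ be the least positive integer with $m_i\equiv i\pmod{a_1}$ and $m_i\in{\rm R}(A)$. Then $$ \sum_{n\in{\rm NR}(A)}(-1)^n n=-\frac{1}{2}\sum_{i=1}^{a_1-1}(-1)^{m_i}m_i+\frac{a_1}{4}\sum_{i=1}^{a_1-1}(-1)^{m_i}+\frac{a_1-1}{4}. $$
   Context: ${\rm R}(A)$ denotes the set of positive integers that can be written as $x_1a_1+\dots+x_ka_k$ with nonnegative integers $x_i$, and ${\rm NR}(A)$ denotes the (finite) set of positive integers not in ${\rm R}(A)$. -}

module Defs where

open import Data.Nat as ℕ using (ℕ; zero; suc; _<_; _≤_)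
open import Data.Nat.GCD using (gcd)
open import Data.Fin using (Fin; zero; suc)
open import Data.Integer as ℤ using (ℤ; +_)
open import Data.Integer.Divisibility as ℤᵈ using ()
open import Data.List using (List; []; _∷_; map; upTo; foldr)
open import Data.Product using (Σ; _×_)
open import Relation.Binary.PropositionalEquality using (_≡_)

Σᶠ : {k : ℕ} → (Fin k → ℕ) → ℕ
Σᶠ {zero}  f = 0
Σᶠ {suc k} f = f zero ℕ.+ Σᶠ (λ i → f (suc i))

gcdᶠ : {k : ℕ} → (Fin k → ℕ) → ℕ
gcdᶠ {zero}  f = 0
gcdᶠ {suc k} f = gcd (f zero) (gcdᶠ (λ i → f (suc i)))

InR : {k : ℕ} → (Fin k → ℕ) → ℕ → Set
InR a n = (0 < n) × Σ (Fin _ → ℕ) (λ x → n ≡ Σᶠ (λ i → x i ℕ.* a i))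

InNR : {k : ℕ} → (Fin k → ℕ) → ℕ → Set
InNR a n = (0 < n) × (InR a n → Data.Empty.⊥)
  where import Data.Empty

_≡_[mod_] : ℕ → ℕ → ℕ → Set
x ≡ y [mod q ] = (+ q) ℤᵈ.∣ ((+ x) ℤ.- (+ y))

IsLeastRep : {k : ℕ} → (Fin k → ℕ) → ℕ → ℕ → ℕ → Set
IsLeastRep a q i m =
  (0 < m × m ≡ i [mod q ] × InR a m) ×
  ((y : ℕ) → 0 < y → y ≡ i [mod q ] → InR a y → m ≤ y)

altℤ : ℕ → ℤ
altℤ n = (ℤ.- (+ 1)) ℤ.^ n ℤ.* (+ n)

sgnℤ : ℕ → ℤ
sgnℤ n = (ℤ.- (+ 1)) ℤ.^ n

sumℤ : List ℤ → ℤ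
sumℤ = foldr ℤ._+_ (+ 0)

range1 : ℕ → List ℕ
range1 n = map suc (upTo n)

-- Write q = a₁ and m_i = i + d_i q. As m_i is the least element of R(A) in its class and
-- R(A) is closed under adding q, the residue class of i (1 ≤ i < q) meets NR(A) exactly in
-- the progression i, i + q, …, i + (d_i − 1) q, while every positive multiple of q lies in R(A).
-- For odd q the potential Φ(n) = q (−1)ⁿ − 2 (−1)ⁿ n satisfies Φ(n + q) − Φ(n) = 4 (−1)ⁿ n,
-- so the alternating sum over each progression telescopes to (Φ(m_i) − Φ(i)) / 4. Summing
-- over i and using Σ_{i=1}^{q−1} Φ(i) = −(q − 1) gives the formula.
module Submission where

open import Defs
open import Data.Nat as ℕ using (ℕ; zero; suc; _<_; _≤_; _∸_; NonZero; z≤n; s≤s)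
import Data.Nat.Properties as ℕ
open import Data.Nat.DivMod
  using (_%_; m≡m%n+[m/n]*n; m%n<n; m<n⇒m%n≡m; %-congˡ; %-remove-+ʳ; [m+kn]%n≡m%n)
  renaming (_/_ to _div_)
open import Data.Nat.Divisibility using (_∣_; divides)
import Data.Nat.Tactic.RingSolver as ℕ-Solver
open import Data.Fin using (Fin; zero; suc)
open import Data.Integer as ℤ using (ℤ; +_; -1ℤ)
import Data.Integer.Properties as ℤ
import Data.Integer.Tactic.RingSolver as ℤ-Solver
open import Data.Rational as ℚ using (ℚ; _/_; toℚᵘ)
import Data.Rational.Properties as ℚ
open import Data.Rational.Unnormalised as ℚᵘ using (mkℚᵘ)
import Data.Rational.Unnormalised.Properties as ℚᵘ
open import Data.List using (List; []; _∷_; _∷ʳ_; _++_; map; upTo; concatMap)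
import Data.List.Properties as List
open import Data.List.Membership.Propositional using (_∈_)
open import Data.List.Membership.Propositional.Properties
  using (∈-map⁺; ∈-map⁻; ∈-upTo⁺; ∈-upTo⁻; ∈-concat⁺′; ∈-concat⁻′)
open import Data.List.Membership.Propositional.Properties.WithK using (unique∧set⇒bag)
import Data.List.Relation.Unary.All as All
import Data.List.Relation.Unary.All.Properties as All
import Data.List.Relation.Unary.AllPairs.Properties as AllPairs
open import Data.List.Relation.Unary.Unique.Propositional using (Unique)
import Data.List.Relation.Unary.Unique.Propositional.Properties as Unique
open import Data.List.Relation.Binary.Disjoint.Propositional using (Disjoint)
open import Data.List.Relation.Binary.Permutation.Propositional using (_↭_; ↭⇒↭ₛ)
import Data.List.Relation.Binary.Permutation.Propositional.Properties as ↭
import Data.List.Relation.Binary.Permutation.Setoid.Properties as ↭ₛ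
open import Data.List.Relation.Binary.BagAndSetEquality using (∼bag⇒↭)
open import Data.Product using (_,_; _×_; proj₁; proj₂; uncurry)
open import Data.Sum using (inj₁; inj₂)
open import Data.Empty using (⊥-elim)
open import Function using (_∘_; id)
open import Function.Bundles using (_⇔_; mk⇔; Equivalence)
open import Function.Definitions using (Injective)
open import Relation.Nullary using (yes; no)
open import Relation.Binary.PropositionalEquality

sumℤ-++ : ∀ xs ys → sumℤ (xs ++ ys) ≡ sumℤ xs ℤ.+ sumℤ ys
sumℤ-++ []       ys = sym (ℤ.+-identityˡ (sumℤ ys))
sumℤ-++ (x ∷ xs) ys = trans (cong (λ s → x ℤ.+ s) (sumℤ-++ xs ys)) (sym (ℤ.+-assoc x _ _))

sumℤ-↭ : ∀ {xs ys} → xs ↭ ys → sumℤ xs ≡ sumℤ ys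
sumℤ-↭ p = ↭ₛ.foldr-commMonoid (setoid ℤ) ℤ.+-0-isCommutativeMonoid (↭⇒↭ₛ p)

sumℤ-map-concatMap : ∀ {A B : Set} (f : B → ℤ) (g : A → List B) xs →
  sumℤ (map f (concatMap g xs)) ≡ sumℤ (map (λ x → sumℤ (map f (g x))) xs)
sumℤ-map-concatMap f g []       = refl
sumℤ-map-concatMap f g (x ∷ xs) = begin
  sumℤ (map f (g x ++ concatMap g xs))
    ≡⟨ cong sumℤ (List.map-++ f (g x) (concatMap g xs)) ⟩
  sumℤ (map f (g x) ++ map f (concatMap g xs))
    ≡⟨ sumℤ-++ (map f (g x)) _ ⟩
  sumℤ (map f (g x)) ℤ.+ sumℤ (map f (concatMap g xs))
    ≡⟨ cong (λ s → sumℤ (map f (g x)) ℤ.+ s) (sumℤ-map-concatMap f g xs) ⟩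
  sumℤ (map (λ x → sumℤ (map f (g x))) (x ∷ xs)) ∎
  where open ≡-Reasoning

sumℤ-map-*ˡ : ∀ {A : Set} c (f : A → ℤ) xs →
  sumℤ (map (λ x → c ℤ.* f x) xs) ≡ c ℤ.* sumℤ (map f xs)
sumℤ-map-*ˡ c f []       = sym (ℤ.*-zeroʳ c)
sumℤ-map-*ˡ c f (x ∷ xs) =
  trans (cong (λ s → c ℤ.* f x ℤ.+ s) (sumℤ-map-*ˡ c f xs)) (sym (ℤ.*-distribˡ-+ c (f x) _))

sumℤ-map-- : ∀ {A : Set} (f g : A → ℤ) xs →
  sumℤ (map (λ x → f x ℤ.- g x) xs) ≡ sumℤ (map f xs) ℤ.- sumℤ (map g xs)
sumℤ-map-- f g []       = refl
sumℤ-map-- f g (x ∷ xs) =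
  trans (cong (λ s → f x ℤ.- g x ℤ.+ s) (sumℤ-map-- f g xs)) (interchange (f x) (g x) _ _)
  where
  interchange : ∀ a b c d → (a ℤ.- b) ℤ.+ (c ℤ.- d) ≡ (a ℤ.+ c) ℤ.- (b ℤ.+ d)
  interchange = ℤ-Solver.solve-∀

sumℤ-map-upTo-suc : ∀ (f : ℕ → ℤ) n →
  sumℤ (map f (upTo (suc n))) ≡ sumℤ (map f (upTo n)) ℤ.+ f n
sumℤ-map-upTo-suc f n = begin
  sumℤ (map f (upTo (suc n)))
    ≡⟨ cong (sumℤ ∘ map f) (List.upTo-∷ʳ n) ⟨
  sumℤ (map f (upTo n ∷ʳ n))
    ≡⟨ cong sumℤ (List.map-++ f (upTo n) (n ∷ [])) ⟩
  sumℤ (map f (upTo n) ++ f n ∷ [])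
    ≡⟨ sumℤ-++ (map f (upTo n)) (f n ∷ []) ⟩
  sumℤ (map f (upTo n)) ℤ.+ (f n ℤ.+ + 0)
    ≡⟨ cong (λ s → sumℤ (map f (upTo n)) ℤ.+ s) (ℤ.+-identityʳ (f n)) ⟩
  sumℤ (map f (upTo n)) ℤ.+ f n ∎
  where open ≡-Reasoning

sumℤ-map-range1-suc : ∀ (f : ℕ → ℤ) n →
  sumℤ (map f (range1 (suc n))) ≡ sumℤ (map f (range1 n)) ℤ.+ f (suc n)
sumℤ-map-range1-suc f n = begin
  sumℤ (map f (range1 (suc n)))
    ≡⟨ cong sumℤ (List.map-∘ {g = f} {f = suc} (upTo (suc n))) ⟨
  sumℤ (map (f ∘ suc) (upTo (suc n)))
    ≡⟨ sumℤ-map-upTo-suc (f ∘ suc) n ⟩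
  sumℤ (map (f ∘ suc) (upTo n)) ℤ.+ f (suc n)
    ≡⟨ cong (λ s → sumℤ s ℤ.+ f (suc n)) (List.map-∘ {g = f} {f = suc} (upTo n)) ⟩
  sumℤ (map f (range1 n)) ℤ.+ f (suc n) ∎
  where open ≡-Reasoning

sumℤ-telescope : ∀ (G : ℕ → ℤ) n →
  sumℤ (map (λ j → G (suc j) ℤ.- G j) (upTo n)) ≡ G n ℤ.- G 0
sumℤ-telescope G zero    = sym (ℤ.+-inverseʳ (G 0))
sumℤ-telescope G (suc n) = begin
  sumℤ (map (λ j → G (suc j) ℤ.- G j) (upTo (suc n)))
    ≡⟨ sumℤ-map-upTo-suc (λ j → G (suc j) ℤ.- G j) n ⟩
  sumℤ (map (λ j → G (suc j) ℤ.- G j) (upTo n)) ℤ.+ (G (suc n) ℤ.- G n)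
    ≡⟨ cong (ℤ._+ (G (suc n) ℤ.- G n)) (sumℤ-telescope G n) ⟩
  (G n ℤ.- G 0) ℤ.+ (G (suc n) ℤ.- G n)
    ≡⟨ cancel (G 0) (G n) (G (suc n)) ⟩
  G (suc n) ℤ.- G 0 ∎
  where
  open ≡-Reasoning
  cancel : ∀ a b c → (b ℤ.- a) ℤ.+ (c ℤ.- b) ≡ c ℤ.- a
  cancel = ℤ-Solver.solve-∀

sgnℤ-+ : ∀ m n → sgnℤ (m ℕ.+ n) ≡ sgnℤ m ℤ.* sgnℤ n
sgnℤ-+ = ℤ.^-distribˡ-+-* -1ℤ

sgnℤ-even : ∀ h → sgnℤ (h ℕ.* 2) ≡ + 1
sgnℤ-even zero    = refl
sgnℤ-even (suc h) = trans (flip² (sgnℤ (h ℕ.* 2))) (sgnℤ-even h)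
  where
  flip² : ∀ s → -1ℤ ℤ.* (-1ℤ ℤ.* s) ≡ s
  flip² = ℤ-Solver.solve-∀

sgnℤ-odd : ∀ h → sgnℤ (suc (h ℕ.* 2)) ≡ -1ℤ
sgnℤ-odd h = cong (-1ℤ ℤ.*_) (sgnℤ-even h)

potential : ℕ → ℕ → ℤ
potential q n = + q ℤ.* sgnℤ n ℤ.- + 2 ℤ.* altℤ n

potential-+-odd : ∀ q → sgnℤ q ≡ -1ℤ → ∀ n →
  potential q (n ℕ.+ q) ℤ.- potential q n ≡ + 4 ℤ.* altℤ n
potential-+-odd q sgn-q n = begin
  potential q (n ℕ.+ q) ℤ.- potential q n
    ≡⟨ cong₂ (λ s N → (+ q ℤ.* s ℤ.- + 2 ℤ.* (s ℤ.* N)) ℤ.- potential q n)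
             (trans (sgnℤ-+ n q) (cong (sgnℤ n ℤ.*_) sgn-q)) (ℤ.pos-+ n q) ⟩
  (+ q ℤ.* (sgnℤ n ℤ.* -1ℤ) ℤ.- + 2 ℤ.* ((sgnℤ n ℤ.* -1ℤ) ℤ.* (+ n ℤ.+ + q)))
    ℤ.- (+ q ℤ.* sgnℤ n ℤ.- + 2 ℤ.* (sgnℤ n ℤ.* + n))
    ≡⟨ ring (+ q) (sgnℤ n) (+ n) ⟩
  + 4 ℤ.* altℤ n ∎
  where
  open ≡-Reasoning
  ring : ∀ Q s N → (Q ℤ.* (s ℤ.* -1ℤ) ℤ.- + 2 ℤ.* ((s ℤ.* -1ℤ) ℤ.* (N ℤ.+ Q)))
                     ℤ.- (Q ℤ.* s ℤ.- + 2 ℤ.* (s ℤ.* N)) ≡ + 4 ℤ.* (s ℤ.* N)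
  ring = ℤ-Solver.solve-∀

potential-odd+even : ∀ q h →
  potential q (suc (h ℕ.* 2)) ℤ.+ potential q (suc (suc (h ℕ.* 2))) ≡ ℤ.- + 2
potential-odd+even q h = begin
  potential q (suc (h ℕ.* 2)) ℤ.+ potential q (suc (suc (h ℕ.* 2)))
    ≡⟨ cong₂ (λ s s′ → (+ q ℤ.* s ℤ.- + 2 ℤ.* (s ℤ.* (+ 1 ℤ.+ N)))
                        ℤ.+ (+ q ℤ.* s′ ℤ.- + 2 ℤ.* (s′ ℤ.* (+ 2 ℤ.+ N))))
             (sgnℤ-odd h) (sgnℤ-even (suc h)) ⟩
  (+ q ℤ.* -1ℤ ℤ.- + 2 ℤ.* (-1ℤ ℤ.* (+ 1 ℤ.+ N)))
    ℤ.+ (+ q ℤ.* + 1 ℤ.- + 2 ℤ.* (+ 1 ℤ.* (+ 2 ℤ.+ N)))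
    ≡⟨ ring (+ q) N ⟩
  ℤ.- + 2 ∎
  where
  open ≡-Reasoning
  N : ℤ
  N = + (h ℕ.* 2)
  ring : ∀ Q N → (Q ℤ.* -1ℤ ℤ.- + 2 ℤ.* (-1ℤ ℤ.* (+ 1 ℤ.+ N)))
                   ℤ.+ (Q ℤ.* + 1 ℤ.- + 2 ℤ.* (+ 1 ℤ.* (+ 2 ℤ.+ N))) ≡ ℤ.- + 2
  ring = ℤ-Solver.solve-∀

sumℤ-potential-range1 : ∀ q h → sumℤ (map (potential q) (range1 (h ℕ.* 2))) ≡ ℤ.- (+ 2 ℤ.* + h)
sumℤ-potential-range1 q zero    = refl
sumℤ-potential-range1 q (suc h) = begin
  sumℤ (map Φ (range1 (suc (suc n))))
    ≡⟨ sumℤ-map-range1-suc Φ (suc n) ⟩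
  sumℤ (map Φ (range1 (suc n))) ℤ.+ Φ (suc (suc n))
    ≡⟨ cong (ℤ._+ Φ (suc (suc n))) (sumℤ-map-range1-suc Φ n) ⟩
  sumℤ (map Φ (range1 n)) ℤ.+ Φ (suc n) ℤ.+ Φ (suc (suc n))
    ≡⟨ ℤ.+-assoc (sumℤ (map Φ (range1 n))) (Φ (suc n)) (Φ (suc (suc n))) ⟩
  sumℤ (map Φ (range1 n)) ℤ.+ (Φ (suc n) ℤ.+ Φ (suc (suc n)))
    ≡⟨ cong₂ ℤ._+_ (sumℤ-potential-range1 q h) (potential-odd+even q h) ⟩
  ℤ.- (+ 2 ℤ.* + h) ℤ.+ ℤ.- + 2
    ≡⟨ ring (+ h) ⟩
  ℤ.- (+ 2 ℤ.* (+ 1 ℤ.+ + h)) ∎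
  where
  open ≡-Reasoning
  Φ : ℕ → ℤ
  Φ = potential q
  n : ℕ
  n = h ℕ.* 2
  ring : ∀ H → ℤ.- (+ 2 ℤ.* H) ℤ.+ ℤ.- + 2 ≡ ℤ.- (+ 2 ℤ.* (+ 1 ℤ.+ H))
  ring = ℤ-Solver.solve-∀

sumℤ-map-potential : ∀ q (g : ℕ → ℕ) xs →
  sumℤ (map (potential q ∘ g) xs)
    ≡ + q ℤ.* sumℤ (map (sgnℤ ∘ g) xs) ℤ.- + 2 ℤ.* sumℤ (map (altℤ ∘ g) xs)
sumℤ-map-potential q g xs = trans (sumℤ-map-- _ _ xs)
  (cong₂ ℤ._-_ (sumℤ-map-*ˡ (+ q) (sgnℤ ∘ g) xs) (sumℤ-map-*ˡ (+ 2) (altℤ ∘ g) xs))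

sumℤ-potential-range1-odd : ∀ {q} h → q ≡ suc (h ℕ.* 2) →
  sumℤ (map (potential q) (range1 (q ∸ 1))) ≡ ℤ.- (+ q ℤ.- + 1)
sumℤ-potential-range1-odd {q} h q≡2h+1 = begin
  sumℤ (map (potential q) (range1 (q ∸ 1)))
    ≡⟨ cong (λ N → sumℤ (map (potential q) (range1 N))) (cong (_∸ 1) q≡2h+1) ⟩
  sumℤ (map (potential q) (range1 (h ℕ.* 2)))
    ≡⟨ sumℤ-potential-range1 q h ⟩
  ℤ.- (+ 2 ℤ.* + h)
    ≡⟨ cong ℤ.-_ (trans (shift (+ h)) (cong (ℤ._- + 1) (sym q≡1+2h))) ⟩
  ℤ.- (+ q ℤ.- + 1) ∎
  where
  open ≡-Reasoning
  q≡1+2h : + q ≡ + 1 ℤ.+ + h ℤ.* + 2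
  q≡1+2h = trans (cong +_ q≡2h+1) (trans (ℤ.pos-+ 1 (h ℕ.* 2)) (cong (λ x → + 1 ℤ.+ x) (ℤ.pos-* h 2)))
  shift : ∀ H → + 2 ℤ.* H ≡ (+ 1 ℤ.+ H ℤ.* + 2) ℤ.- + 1
  shift = ℤ-Solver.solve-∀

progression : ℕ → ℕ → ℕ → List ℕ
progression q i t = map (λ j → i ℕ.+ j ℕ.* q) (upTo t)

sumℤ-altℤ-progression : ∀ {q} → sgnℤ q ≡ -1ℤ → ∀ i t →
  + 4 ℤ.* sumℤ (map altℤ (progression q i t)) ≡ potential q (i ℕ.+ t ℕ.* q) ℤ.- potential q i
sumℤ-altℤ-progression {q} sgn-q i t = begin
  + 4 ℤ.* sumℤ (map altℤ (progression q i t))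
    ≡⟨ cong (λ s → + 4 ℤ.* sumℤ s) (List.map-∘ {g = altℤ} {f = term} (upTo t)) ⟨
  + 4 ℤ.* sumℤ (map (altℤ ∘ term) (upTo t))
    ≡⟨ sumℤ-map-*ˡ (+ 4) (altℤ ∘ term) (upTo t) ⟨
  sumℤ (map (λ j → + 4 ℤ.* altℤ (term j)) (upTo t))
    ≡⟨ cong sumℤ (List.map-cong step (upTo t)) ⟩
  sumℤ (map (λ j → G (suc j) ℤ.- G j) (upTo t))
    ≡⟨ sumℤ-telescope G t ⟩
  G t ℤ.- G 0
    ≡⟨ cong (λ n → G t ℤ.- potential q n) (ℕ.+-identityʳ i) ⟩
  potential q (i ℕ.+ t ℕ.* q) ℤ.- potential q i ∎
  where
  open ≡-Reasoning
  term : ℕ → ℕ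
  term j = i ℕ.+ j ℕ.* q
  G : ℕ → ℤ
  G = potential q ∘ term
  step : ∀ j → + 4 ℤ.* altℤ (term j) ≡ G (suc j) ℤ.- G j
  step j = trans (sym (potential-+-odd q sgn-q (term j)))
                 (cong (λ n → potential q n ℤ.- G j)
                       (trans (ℕ.+-assoc i (j ℕ.* q) q) (cong (i ℕ.+_) (ℕ.+-comm (j ℕ.* q) q))))

∣+x-+y∣≡y∸x : ∀ {x y} → x ≤ y → ℤ.∣ + x ℤ.- + y ∣ ≡ y ∸ x
∣+x-+y∣≡y∸x {x} {y} x≤y = trans (cong ℤ.∣_∣ (ℤ.m-n≡m⊖n x y)) (ℤ.∣⊖∣-≤ x≤y)

∣+x-+y∣≡x∸y : ∀ {x y} → y ≤ x → ℤ.∣ + x ℤ.- + y ∣ ≡ x ∸ y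
∣+x-+y∣≡x∸y {x} {y} y≤x =
  trans (cong ℤ.∣_∣ (ℤ.m-n≡m⊖n x y)) (trans (ℤ.∣m⊖n∣≡∣n⊖m∣ x y) (ℤ.∣⊖∣-≤ y≤x))

module _ {q : ℕ} .{{_ : NonZero q}} where

  ∸-∣⇒%≡ : ∀ {x y} → y ≤ x → q ∣ x ∸ y → x % q ≡ y % q
  ∸-∣⇒%≡ {x} {y} y≤x q∣x∸y =
    trans (%-congˡ (sym (ℕ.m+[n∸m]≡n y≤x))) (%-remove-+ʳ y q∣x∸y)

  ≡[mod]⇒%≡ : ∀ {x y} → x ≡ y [mod q ] → x % q ≡ y % q
  ≡[mod]⇒%≡ {x} {y} q∣x-y with ℕ.≤-total y x
  ... | inj₁ y≤x = ∸-∣⇒%≡ y≤x (subst (q ∣_) (∣+x-+y∣≡x∸y y≤x) q∣x-y)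
  ... | inj₂ x≤y = sym (∸-∣⇒%≡ x≤y (subst (q ∣_) (∣+x-+y∣≡y∸x x≤y) q∣x-y))

  +*≡[mod] : ∀ i j → (i ℕ.+ j ℕ.* q) ≡ i [mod q ]
  +*≡[mod] i j = divides j (trans (∣+x-+y∣≡x∸y (ℕ.m≤m+n i (j ℕ.* q))) (ℕ.m+n∸m≡n i (j ℕ.* q)))

Σᶠ-zero : ∀ k → Σᶠ {k} (λ _ → 0) ≡ 0
Σᶠ-zero zero    = refl
Σᶠ-zero (suc k) = Σᶠ-zero k

module _ {k : ℕ} (a : Fin (suc k) → ℕ) where

  InR-multiple : ∀ c → 0 < c ℕ.* a zero → InR a (c ℕ.* a zero)
  InR-multiple c 0<c*a₀ = 0<c*a₀ , x , sym (trans (cong (c ℕ.* a zero ℕ.+_) (Σᶠ-zero k)) (ℕ.+-identityʳ _))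
    where
    x : Fin (suc k) → ℕ
    x zero    = c
    x (suc _) = 0

  InR-+-multiple : ∀ {n} → InR a n → ∀ c → InR a (n ℕ.+ c ℕ.* a zero)
  InR-+-multiple {n} (0<n , x , n≡) c = ℕ.<-≤-trans 0<n (ℕ.m≤m+n n _) , x′ , n+c*a₀≡
    where
    x′ : Fin (suc k) → ℕ
    x′ zero    = x zero ℕ.+ c
    x′ (suc i) = x (suc i)
    rearrange : ∀ x₀ c a₀ S → (x₀ ℕ.* a₀ ℕ.+ S) ℕ.+ c ℕ.* a₀ ≡ (x₀ ℕ.+ c) ℕ.* a₀ ℕ.+ S
    rearrange = ℕ-Solver.solve-∀
    n+c*a₀≡ : n ℕ.+ c ℕ.* a zero ≡ Σᶠ (λ i → x′ i ℕ.* a i)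
    n+c*a₀≡ = trans (cong (ℕ._+ c ℕ.* a zero) n≡) (rearrange (x zero) c (a zero) _)

∈-range1⁺ : ∀ {N i} → 1 ≤ i → i ≤ N → i ∈ range1 N
∈-range1⁺ {i = suc i} _ i<N = ∈-map⁺ suc (∈-upTo⁺ i<N)

∈-range1⁻ : ∀ {N i} → i ∈ range1 N → 1 ≤ i × i ≤ N
∈-range1⁻ i∈ with ∈-map⁻ suc i∈
... | _ , r∈ , refl = s≤s z≤n , ∈-upTo⁻ r∈

module Gaps (q : ℕ) .{{_ : NonZero q}} (T : ℕ → ℕ) where

  block : ℕ → List ℕ
  block i = progression q i (T i)

  gaps : List ℕ
  gaps = concatMap block (range1 (q ∸ 1))

  data Gap : ℕ → Set where
    gap : ∀ {i j} → 1 ≤ i → i ≤ q ∸ 1 → j < T i → Gap (i ℕ.+ j ℕ.* q)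

  ∈-gaps⁺ : ∀ {n} → Gap n → n ∈ gaps
  ∈-gaps⁺ (gap {i} 1≤i i≤q-1 j<Tᵢ) =
    ∈-concat⁺′ (∈-map⁺ (λ j → i ℕ.+ j ℕ.* q) (∈-upTo⁺ j<Tᵢ))
               (∈-map⁺ block (∈-range1⁺ 1≤i i≤q-1))

  ∈-gaps⁻ : ∀ {n} → n ∈ gaps → Gap n
  ∈-gaps⁻ n∈ with ∈-concat⁻′ (map block (range1 (q ∸ 1))) n∈
  ... | _ , n∈block , block∈ with ∈-map⁻ block block∈
  ... | i , i∈ , refl with ∈-map⁻ (λ j → i ℕ.+ j ℕ.* q) n∈block | ∈-range1⁻ i∈
  ... | j , j∈ , refl | 1≤i , i≤q-1 = gap 1≤i i≤q-1 (∈-upTo⁻ j∈)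

  ≤pred⇒< : ∀ {i} → i ≤ q ∸ 1 → i < q
  ≤pred⇒< {i} i≤q-1 = subst (i <_) (ℕ.suc-pred q) (s≤s i≤q-1)

  ∈-block⇒% : ∀ {i x} → i < q → x ∈ block i → x % q ≡ i
  ∈-block⇒% {i} i<q x∈ with ∈-map⁻ (λ j → i ℕ.+ j ℕ.* q) x∈
  ... | j , _ , refl = trans ([m+kn]%n≡m%n i j q) (m<n⇒m%n≡m i<q)

  gaps-unique : Unique gaps
  gaps-unique = Unique.concat⁺ (All.map⁺ (All.universal block-unique _))
    (AllPairs.map⁺ (AllPairs.map⁺ (AllPairs.applyUpTo⁺₁ id (q ∸ 1) disjoint)))
    where
    block-unique : ∀ i → Unique (block i)
    block-unique i = Unique.map⁺ (λ {j} {j′} eq → ℕ.*-cancelʳ-≡ j j′ q (ℕ.+-cancelˡ-≡ i _ _ eq))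
                                 (Unique.upTo⁺ (T i))
    disjoint : ∀ {r s} → r < s → s < q ∸ 1 → Disjoint (block (suc r)) (block (suc s))
    disjoint r<s s<q-1 (x∈r , x∈s) =
      ℕ.<⇒≢ (s≤s r<s) (trans (sym (∈-block⇒% (≤pred⇒< (ℕ.<-trans r<s s<q-1)) x∈r))
                             (∈-block⇒% (≤pred⇒< s<q-1) x∈s))

  sumℤ-altℤ-gaps : sgnℤ q ≡ -1ℤ →
    + 4 ℤ.* sumℤ (map altℤ gaps)
      ≡ sumℤ (map (λ i → potential q (i ℕ.+ T i ℕ.* q) ℤ.- potential q i) (range1 (q ∸ 1)))
  sumℤ-altℤ-gaps sgn-q = begin
    + 4 ℤ.* sumℤ (map altℤ gaps)
      ≡⟨ cong (+ 4 ℤ.*_) (sumℤ-map-concatMap altℤ block (range1 (q ∸ 1))) ⟩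
    + 4 ℤ.* sumℤ (map (λ i → sumℤ (map altℤ (block i))) (range1 (q ∸ 1)))
      ≡⟨ sumℤ-map-*ˡ (+ 4) _ (range1 (q ∸ 1)) ⟨
    sumℤ (map (λ i → + 4 ℤ.* sumℤ (map altℤ (block i))) (range1 (q ∸ 1)))
      ≡⟨ cong sumℤ (List.map-cong (λ i → sumℤ-altℤ-progression sgn-q i (T i)) (range1 (q ∸ 1))) ⟩
    sumℤ (map (λ i → potential q (i ℕ.+ T i ℕ.* q) ℤ.- potential q i) (range1 (q ∸ 1))) ∎
    where open ≡-Reasoning

module _ {k : ℕ} (a : Fin (suc k) → ℕ) .{{_ : NonZero (a zero)}} (m : ℕ → ℕ)
         (least : ∀ i → 1 ≤ i → i ≤ a zero ∸ 1 → IsLeastRep a (a zero) i (m i)) where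

  private
    q : ℕ
    q = a zero

  depth : ℕ → ℕ
  depth i = m i div q

  open Gaps q depth

  m≡i+depth*q : ∀ {i} → 1 ≤ i → i ≤ q ∸ 1 → m i ≡ i ℕ.+ depth i ℕ.* q
  m≡i+depth*q {i} 1≤i i≤q-1 = trans (m≡m%n+[m/n]*n (m i) q) (cong (ℕ._+ depth i ℕ.* q) mᵢ%q≡i)
    where
    mᵢ≡i : m i ≡ i [mod q ]
    mᵢ≡i = proj₁ (proj₂ (proj₁ (least i 1≤i i≤q-1)))
    mᵢ%q≡i : m i % q ≡ i
    mᵢ%q≡i = trans (≡[mod]⇒%≡ mᵢ≡i) (m<n⇒m%n≡m (≤pred⇒< i≤q-1))

  Gap⇒InNR : ∀ {n} → Gap n → InNR a n
  Gap⇒InNR (gap {i} {j} 1≤i i≤q-1 j<dᵢ) = 0<n , n∉R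
    where
    0<n : 0 < i ℕ.+ j ℕ.* q
    0<n = ℕ.<-≤-trans 1≤i (ℕ.m≤m+n i (j ℕ.* q))
    n<mᵢ : i ℕ.+ j ℕ.* q < m i
    n<mᵢ = subst (i ℕ.+ j ℕ.* q <_) (sym (m≡i+depth*q 1≤i i≤q-1)) (ℕ.+-monoʳ-< i (ℕ.*-monoˡ-< q j<dᵢ))
    n∉R : InR a (i ℕ.+ j ℕ.* q) → _
    n∉R n∈R = ℕ.<⇒≱ n<mᵢ (proj₂ (least i 1≤i i≤q-1) _ 0<n (+*≡[mod] i j) n∈R)

  InNR⇒Gap : ∀ {n} → InNR a n → Gap n
  InNR⇒Gap {n} (0<n , n∉R) with n % q ℕ.≟ 0 | n div q ℕ.<? depth (n % q)
  ... | yes r≡0 | _ =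
    ⊥-elim (n∉R (subst (InR a) (sym n≡dq) (InR-multiple a (n div q) (subst (0 <_) n≡dq 0<n))))
    where
    n≡dq : n ≡ n div q ℕ.* q
    n≡dq = trans (m≡m%n+[m/n]*n n q) (cong (ℕ._+ n div q ℕ.* q) r≡0)
  ... | no r≢0 | yes d<dᵣ =
    subst Gap (sym (m≡m%n+[m/n]*n n q)) (gap (ℕ.n≢0⇒n>0 r≢0) (ℕ.<⇒≤pred (m%n<n n q)) d<dᵣ)
  ... | no r≢0 | no d≮dᵣ = ⊥-elim (n∉R (subst (InR a) (sym n≡mᵣ+cq) (InR-+-multiple a mᵣ∈R c)))
    where
    r c : ℕ
    r = n % q
    c = n div q ∸ depth r
    1≤r : 1 ≤ r
    1≤r = ℕ.n≢0⇒n>0 r≢0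
    r≤q-1 : r ≤ q ∸ 1
    r≤q-1 = ℕ.<⇒≤pred (m%n<n n q)
    d≥dᵣ : depth r ≤ n div q
    d≥dᵣ = ℕ.≮⇒≥ d≮dᵣ
    mᵣ∈R : InR a (m r)
    mᵣ∈R = proj₂ (proj₂ (proj₁ (least r 1≤r r≤q-1)))
    n≡mᵣ+cq : n ≡ m r ℕ.+ c ℕ.* q
    n≡mᵣ+cq = begin
      n                                  ≡⟨ m≡m%n+[m/n]*n n q ⟩
      r ℕ.+ n div q ℕ.* q                ≡⟨ cong (λ d → r ℕ.+ d ℕ.* q) (ℕ.m+[n∸m]≡n d≥dᵣ) ⟨
      r ℕ.+ (depth r ℕ.+ c) ℕ.* q        ≡⟨ rearrange r (depth r) c q ⟩
      (r ℕ.+ depth r ℕ.* q) ℕ.+ c ℕ.* q  ≡⟨ cong (ℕ._+ c ℕ.* q) (m≡i+depth*q 1≤r r≤q-1) ⟨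
      m r ℕ.+ c ℕ.* q                    ∎
      where
      open ≡-Reasoning
      rearrange : ∀ r d c q → r ℕ.+ (d ℕ.+ c) ℕ.* q ≡ (r ℕ.+ d ℕ.* q) ℕ.+ c ℕ.* q
      rearrange = ℕ-Solver.solve-∀

  NR↭gaps : ∀ {NR} → Unique NR → (∀ n → (n ∈ NR) ⇔ InNR a n) → NR ↭ gaps
  NR↭gaps {NR} NR! NR⇔ = ∼bag⇒↭ (unique∧set⇒bag NR! gaps-unique (λ {n} → mk⇔
    (∈-gaps⁺ ∘ InNR⇒Gap ∘ Equivalence.to (NR⇔ n))
    (Equivalence.from (NR⇔ n) ∘ Gap⇒InNR ∘ ∈-gaps⁻)))

  sumℤ-altℤ-NR-telescoped : sgnℤ q ≡ -1ℤ → ∀ {NR} → Unique NR → (∀ n → (n ∈ NR) ⇔ InNR a n) →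
    + 4 ℤ.* sumℤ (map altℤ NR)
      ≡ sumℤ (map (potential q ∘ m) (range1 (q ∸ 1))) ℤ.- sumℤ (map (potential q) (range1 (q ∸ 1)))
  sumℤ-altℤ-NR-telescoped sgn-q {NR} NR! NR⇔ = begin
    + 4 ℤ.* sumℤ (map altℤ NR)
      ≡⟨ cong (+ 4 ℤ.*_) (sumℤ-↭ (↭.map⁺ altℤ (NR↭gaps NR! NR⇔))) ⟩
    + 4 ℤ.* sumℤ (map altℤ gaps)
      ≡⟨ sumℤ-altℤ-gaps sgn-q ⟩
    sumℤ (map (λ i → potential q (i ℕ.+ depth i ℕ.* q) ℤ.- potential q i) R)
      ≡⟨ cong sumℤ (List.map-cong-local (All.tabulate λ {i} i∈ →
           cong (λ n → potential q n ℤ.- potential q i) (sym (uncurry m≡i+depth*q (∈-range1⁻ i∈))))) ⟩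
    sumℤ (map (λ i → potential q (m i) ℤ.- potential q i) R)
      ≡⟨ sumℤ-map-- (potential q ∘ m) (potential q) R ⟩
    sumℤ (map (potential q ∘ m) R) ℤ.- sumℤ (map (potential q) R) ∎
    where
    open ≡-Reasoning
    R : List ℕ
    R = range1 (q ∸ 1)

  sumℤ-altℤ-NR : ∀ h → q ≡ suc (h ℕ.* 2) → ∀ {NR} → Unique NR → (∀ n → (n ∈ NR) ⇔ InNR a n) →
    + 4 ℤ.* sumℤ (map altℤ NR)
      ≡ ℤ.- + 2 ℤ.* sumℤ (map (altℤ ∘ m) (range1 (q ∸ 1)))
        ℤ.+ + q ℤ.* sumℤ (map (sgnℤ ∘ m) (range1 (q ∸ 1))) ℤ.+ (+ q ℤ.- + 1)
  sumℤ-altℤ-NR h q≡2h+1 {NR} NR! NR⇔ = begin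
    + 4 ℤ.* sumℤ (map altℤ NR)
      ≡⟨ sumℤ-altℤ-NR-telescoped (trans (cong sgnℤ q≡2h+1) (sgnℤ-odd h)) NR! NR⇔ ⟩
    sumℤ (map (potential q ∘ m) R) ℤ.- sumℤ (map (potential q) R)
      ≡⟨ cong₂ ℤ._-_ (sumℤ-map-potential q m R) (sumℤ-potential-range1-odd h q≡2h+1) ⟩
    (+ q ℤ.* B ℤ.- + 2 ℤ.* A) ℤ.- ℤ.- (+ q ℤ.- + 1)
      ≡⟨ ring (+ q) A B ⟩
    ℤ.- + 2 ℤ.* A ℤ.+ + q ℤ.* B ℤ.+ (+ q ℤ.- + 1) ∎
    where
    open ≡-Reasoning
    R : List ℕ
    R = range1 (q ∸ 1)
    A B : ℤ
    A = sumℤ (map (altℤ ∘ m) R)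
    B = sumℤ (map (sgnℤ ∘ m) R)
    ring : ∀ Q A B → (Q ℤ.* B ℤ.- + 2 ℤ.* A) ℤ.- ℤ.- (Q ℤ.- + 1)
                   ≡ ℤ.- + 2 ℤ.* A ℤ.+ Q ℤ.* B ℤ.+ (Q ℤ.- + 1)
    ring = ℤ-Solver.solve-∀

toℚᵘ-/ : ∀ i d → toℚᵘ (i / suc d) ℚᵘ.≃ mkℚᵘ i d
toℚᵘ-/ i d = ℚ.toℚᵘ-fromℚᵘ (mkℚᵘ i d)

/1-from-×4 : ∀ L A B Q → + 4 ℤ.* L ≡ ℤ.- + 2 ℤ.* A ℤ.+ Q ℤ.* B ℤ.+ (Q ℤ.- + 1) →
  L / 1 ≡ (ℚ.- (+ 1 / 2)) ℚ.* (A / 1) ℚ.+ (Q / 4) ℚ.* (B / 1) ℚ.+ ((Q ℤ.- + 1) / 4)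
/1-from-×4 L A B Q 4L≡ = ℚ.toℚᵘ-injective (begin
  toℚᵘ (L / 1)
    ≈⟨ toℚᵘ-/ L 0 ⟩
  mkℚᵘ L 0
    ≈⟨ ℚᵘ.*≡* cross-multiplied ⟩
  (ℚᵘ.- mkℚᵘ (+ 1) 1) ℚᵘ.* mkℚᵘ A 0 ℚᵘ.+ mkℚᵘ Q 3 ℚᵘ.* mkℚᵘ B 0 ℚᵘ.+ mkℚᵘ (Q ℤ.- + 1) 3
    ≈⟨ ℚᵘ.+-cong (ℚᵘ.+-cong (ℚᵘ.*-cong -½≃ (toℚᵘ-/ A 0)) (ℚᵘ.*-cong (toℚᵘ-/ Q 3) (toℚᵘ-/ B 0)))
                 (toℚᵘ-/ (Q ℤ.- + 1) 3) ⟨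
  toℚᵘ -½ ℚᵘ.* toℚᵘ (A / 1) ℚᵘ.+ toℚᵘ (Q / 4) ℚᵘ.* toℚᵘ (B / 1) ℚᵘ.+ toℚᵘ z
    ≈⟨ ℚᵘ.+-congˡ (toℚᵘ z)
         (ℚᵘ.+-cong (ℚ.toℚᵘ-homo-* -½ (A / 1)) (ℚ.toℚᵘ-homo-* (Q / 4) (B / 1))) ⟨
  toℚᵘ x ℚᵘ.+ toℚᵘ y ℚᵘ.+ toℚᵘ z
    ≈⟨ ℚᵘ.+-congˡ (toℚᵘ z) (ℚ.toℚᵘ-homo-+ x y) ⟨
  toℚᵘ (x ℚ.+ y) ℚᵘ.+ toℚᵘ z
    ≈⟨ ℚ.toℚᵘ-homo-+ (x ℚ.+ y) z ⟨
  toℚᵘ (x ℚ.+ y ℚ.+ z) ∎)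
  where
  open ℚᵘ.≃-Reasoning
  -½ x y z : ℚ
  -½ = ℚ.- (+ 1 / 2)
  x = -½ ℚ.* (A / 1)
  y = (Q / 4) ℚ.* (B / 1)
  z = (Q ℤ.- + 1) / 4
  -½≃ : toℚᵘ -½ ℚᵘ.≃ ℚᵘ.- mkℚᵘ (+ 1) 1
  -½≃ = ℚᵘ.≃-trans (ℚ.toℚᵘ-homo‿- (+ 1 / 2)) (ℚᵘ.-‿cong (toℚᵘ-/ (+ 1) 1))
  numerator : ℤ
  numerator = ((-1ℤ ℤ.* A) ℤ.* + 4 ℤ.+ (Q ℤ.* B) ℤ.* + 2) ℤ.* + 4 ℤ.+ (Q ℤ.- + 1) ℤ.* + 8
  scale : ∀ L → L ℤ.* + 32 ≡ + 8 ℤ.* (+ 4 ℤ.* L)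
  scale = ℤ-Solver.solve-∀
  expand : ∀ A B Q → + 8 ℤ.* (ℤ.- + 2 ℤ.* A ℤ.+ Q ℤ.* B ℤ.+ (Q ℤ.- + 1))
    ≡ (((-1ℤ ℤ.* A) ℤ.* + 4 ℤ.+ (Q ℤ.* B) ℤ.* + 2) ℤ.* + 4 ℤ.+ (Q ℤ.- + 1) ℤ.* + 8) ℤ.* + 1
  expand = ℤ-Solver.solve-∀
  -- ℚᵘ._+_ and ℚᵘ._*_ give the right-hand side the denominator 2 · 4 · 4 = 32.
  cross-multiplied : L ℤ.* + 32 ≡ numerator ℤ.* + 1
  cross-multiplied = trans (scale L) (trans (cong (+ 8 ℤ.*_) 4L≡) (expand A B Q))

-- Coprimality and distinctness of the aᵢ (and k ≥ 1) only serve to make NR(A) finite and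
-- the m_i exist; both are supplied here as data.
corollary1 : (k : ℕ) → 2 ≤ suc k → (a : Fin (suc k) → ℕ) →
    Injective _≡_ _≡_ a → (∀ j → 0 < a j) → gcdᶠ a ≡ 1 → a zero ℕ.% 2 ≡ 1 →
    (NR : List ℕ) → Unique NR → (∀ n → (n ∈ NR) ⇔ InNR a n) →
    (m : ℕ → ℕ) → (∀ i → 1 ≤ i → i ≤ a zero ∸ 1 → IsLeastRep a (a zero) i (m i)) →
    (sumℤ (map altℤ NR) / 1)
      ≡ (ℚ.- (+ 1 / 2)) ℚ.* (sumℤ (map (λ i → altℤ (m i)) (range1 (a zero ∸ 1))) / 1)
        ℚ.+ (+ a zero / 4) ℚ.* (sumℤ (map (λ i → sgnℤ (m i)) (range1 (a zero ∸ 1))) / 1)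
        ℚ.+ ((+ a zero ℤ.- + 1) / 4)
corollary1 k _ a _ a>0 _ a₀-odd NR NR! NR⇔ m least =
  /1-from-×4 (sumℤ (map altℤ NR)) (sumℤ (map (altℤ ∘ m) R)) (sumℤ (map (sgnℤ ∘ m) R)) (+ a zero)
    (sumℤ-altℤ-NR a m least h a₀≡2h+1 NR! NR⇔)
  where
  R : List ℕ
  R = range1 (a zero ∸ 1)
  instance
    a₀≢0 : NonZero (a zero)
    a₀≢0 = ℕ.>-nonZero (a>0 zero)
  h : ℕ
  h = a zero div 2
  a₀≡2h+1 : a zero ≡ suc (h ℕ.* 2)
  a₀≡2h+1 = trans (m≡m%n+[m/n]*n (a zero) 2) (cong (ℕ._+ h ℕ.* 2) a₀-odd)
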